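{- Let $k\ge2$, $n\in\mathbb{N}$ and $w,w'\in S_n$. If the number of descents of $\mathcal{C}_{k,n,w}$ is greater than that of $\mathcal{C}_{k,n,w'}$, then $\operatorname{rev}(\operatorname{supp}(c_w))$ is lexicographically later than $\operatorname{rev}(\operatorname{supp}(c_{w'}))$.
   Context: The infinite rooted directed $k$-ary tree has a root on layer $1$; every vertex has $k$ children, ordered left to right, on the next layer. A vertex with at least $k$ chips may fire by choosing $k$ of its labeled chips and sending the $j$th smallest to its $j$th leftmost child. Chips $0,\dots,k^n-1$ start at the root and are written in $n$-digit $k$-ary expansion. For $w\in S_n$, the strategy $F_w$ fires, for each $i\in[n]$, each vertex $v$ on layer $i$ so that all chips on $v$ whose $w_i$th most significant digit equals $j$ go to the $(j+1)$th leftmost child of $v$. $\mathcal{C}_{k,n,w}=(\pi_1,\dots,\pi_{k^n})$ is the resulting stable configuration, read as the sequence of chips on layer $n+1$ from left to right; a descent is an $i\in[k^n-1]$ with $\pi_i>\pi_{i+1}$. The Lehmer code of $w$ is $c_w$ with $(c_w)_i=\#\{j>i:w_j<w_i\}$. Here $\operatorname{supp}(c_w)$ is viewed as the binary string of length $n$ whose $i$th entry is $1$ if $(c_w)_i\neq0$ and $0$ otherwise, and $\operatorname{rev}$ denotes reversal of a string; strings are compared lexicographically. -}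

module Defs where

open import Data.Nat using (ℕ; zero; suc; _^_; _∸_; _<ᵇ_)
open import Data.Nat.DivMod using (_/_; _%_)
open import Data.Nat.Properties using (m^n≢0)
open import Data.Bool using (Bool; true; false; not)
import Data.Bool as B
open import Data.Fin using (Fin; toℕ)
import Data.Fin as F
open import Data.Fin.Permutation using (Permutation′; _⟨$⟩ʳ_)
open import Data.List using (List; []; _∷_; map; concat; concatMap; upTo; length; filter; allFin; reverse)
open import Data.List.Relation.Binary.Lex.Strict using (Lex-<)
open import Relation.Binary.PropositionalEquality using (_≡_)
open import Relation.Nullary.Decidable using (_×-dec_)
import Data.Nat as N

-- digit k n p c : the p-th most significant digit (p = 1..n) of the
-- n-digit base-k expansion of c, i.e. ⌊ c / k^(n-p) ⌋ mod k.
digit : ℕ → ℕ → ℕ → ℕ → ℕ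
digit zero n p c = 0
digit (suc k) n p c =
  (_/_ c (suc k ^ (n ∸ p)) {{m^n≢0 (suc k) (n ∸ p)}}) % suc k

-- A vertex on a layer is represented by the list of chips on it; a layer
-- is the list of its vertices from left to right.
fireVertex : ℕ → ℕ → ℕ → List ℕ → List (List ℕ)
fireVertex k n p chips =
  map (λ j → filter (λ c → digit k n p c N.≟ j) chips) (upTo k)

fireLayer : ℕ → ℕ → ℕ → List (List ℕ) → List (List ℕ)
fireLayer k n p layer = concatMap (fireVertex k n p) layer

-- The digit position w_i (1-based) for a 0-based index i : Fin n.
wpos : ∀ {n} → Permutation′ n → Fin n → ℕ
wpos w i = suc (toℕ (w ⟨$⟩ʳ i))

runLayers : ℕ → ℕ → List ℕ → List (List ℕ) → List (List ℕ)
runLayers k n [] layer = layer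
runLayers k n (p ∷ ps) layer = runLayers k n ps (fireLayer k n p layer)

-- Stable configuration C_{k,n,w}: chips on layer n+1 read left to right.
config : (k n : ℕ) → Permutation′ n → List ℕ
config k n w =
  concat (runLayers k n (map (wpos w) (allFin n)) ((upTo (k ^ n)) ∷ []))

descents : List ℕ → ℕ
descents [] = 0
descents (x ∷ []) = 0
descents (x ∷ (y ∷ xs)) = B.if y N.<ᵇ x then suc (descents (y ∷ xs)) else descents (y ∷ xs)

lehmer : ∀ {n} → Permutation′ n → Fin n → ℕ
lehmer {n} w i =
  length (filter (λ j → (i F.<? j) ×-dec ((w ⟨$⟩ʳ j) F.<? (w ⟨$⟩ʳ i))) (allFin n))

-- supp(c_w) as a binary string of length n (true = 1, false = 0)
supp : ∀ {n} → Permutation′ n → List Bool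
supp {n} w = map (λ i → not (lehmer w i N.≡ᵇ 0)) (allFin n)

_<lex_ : List Bool → List Bool → Set
_<lex_ = Lex-< _≡_ B._<_

{-# OPTIONS --safe #-}
-- Firing at digit position p splits the chips of a vertex by their p-th digit, so below a vertex
-- of layer i sit the numbers whose digits at w_1, ..., w_{i-1} are prescribed, in increasing order;
-- the first of them has its free digits all 0 and the last all k-1. The chips reaching layer n+1
-- below such a vertex therefore form k consecutive blocks, one per value of digit w_i, with equal
-- descent counts, and the junction between two neighbouring blocks is a descent exactly when some
-- w_j with j > i is a more significant position than w_i, i.e. when (c_w)_i ≠ 0. Hence the number
-- of descents is (k-1) Σ_i [(c_w)_i ≠ 0] k^(i-1): (k-1) times the base-k number whose digits, most
-- significant first, form rev(supp(c_w)), and such numbers compare like the strings lexicographically.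
module Submission where

open import Defs
open import Data.Nat using (ℕ; _≤_; _>_)
open import Data.List using (reverse)
open import Data.Fin.Permutation using (Permutation′)

open import Data.Bool using (Bool; true; false; not; if_then_else_)
import Data.Bool as B
open import Data.Empty using (⊥-elim)
open import Data.Fin as F using (Fin; toℕ; fromℕ; inject₁)
open import Data.Fin.Permutation using (_⟨$⟩ʳ_; _⟨$⟩ˡ_; inverseʳ)
open import Data.Fin.Properties using (toℕ<n; toℕ-fromℕ; ≤̄⇒inject₁<)
open import Data.List
  using (List; []; _∷_; _++_; _∷ʳ_; map; concat; concatMap; filter; tabulate; applyUpTo; upTo; allFin; length)
open import Data.List.Membership.Propositional using (_∈_; find; lose)
open import Data.List.Membership.Propositional.Properties using (∈-tabulate⁺)
open import Data.List.Properties
  using (++-identityʳ; map-id; map-∘; map-cong; map-tabulate; tabulate-cong; concat-map; concat-++; concatMap-map;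
         concatMap-++; map-upTo; filter-++; filter-≐; ∷-injectiveˡ; unfold-reverse; length-reverse; length-map;
         length-tabulate; length-++)
open import Data.List.Relation.Binary.Lex.Core using (this; next)
open import Data.List.Relation.Unary.All as All using (All)
open import Data.List.Relation.Unary.AllPairs using (_∷_)
open import Data.List.Relation.Unary.Any using (here; there; any?)
open import Data.List.Relation.Unary.Unique.Propositional using (Unique)
open import Data.List.Relation.Unary.Unique.Propositional.Properties using (tabulate⁺)
open import Data.Maybe using (Maybe; just; nothing; fromMaybe)
open import Data.Nat using (zero; suc; _+_; _*_; _^_; _∸_; _<_; _<ᵇ_; _≡ᵇ_; _≟_; _<?_; NonZero; s≤s; z≤n)
open import Data.Nat.DivMod using (_/_; _%_; +-distrib-/-∣ˡ; m*n/n≡m; m<n⇒m/n≡0; m<n⇒m%n≡m; [m+kn]%n≡m%n)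
open import Data.Nat.Divisibility using (n∣m*n)
open import Data.Nat.Properties
  using (+-comm; +-assoc; +-identityʳ; *-identityˡ; *-zeroʳ; +-monoʳ-<; *-monoˡ-≤; *-cancelˡ-<; +-cancelˡ-<;
         ≤-refl; ≤-trans; ≤-reflexive; <-≤-trans; ≤-<-trans; <-trans; <-irrefl; <⇒≯; m≤m+n; m^n≢0; m+[n∸m]≡n;
         ^-distribˡ-+-*; suc-injective)
open import Data.Nat.Tactic.RingSolver using (solve-∀)
open import Data.Product using (_,_; ∃; _×_)
open import Data.Vec as V using (Vec; _[_]≔_)
open import Data.Vec.Properties using (lookup-map; lookup-replicate; map-[]≔; []≔-lookup; lookup∘update; lookup∘update′)
open import Function using (_∘_; id; case_of_; _⇔_; mk⇔; Equivalence)
open import Function.Bundles using (Injection)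
open import Function.Properties.Inverse using (Inverse⇒Injection)
open import Level using (Level)
open import Relation.Binary.PropositionalEquality
open import Relation.Nullary using (Dec; yes; no; does; _×-dec_)
open import Relation.Nullary.Decidable using (dec-true; dec-false)
open import Relation.Unary using (Pred; Decidable; _≐_)

private
  variable
    ℓ ℓ′ : Level
    A B : Set

open ≡-Reasoning
open Equivalence using (to; from)

m*o+n<[1+m]*o : ∀ m {n o} → n < o → m * o + n < suc m * o
m*o+n<[1+m]*o m {n} {o} n<o = subst (m * o + n <_) (+-comm (m * o) o) (+-monoʳ-< (m * o) n<o)

[m*n*o+r]/o%n≡r/o%n : ∀ m r n o .{{_ : NonZero n}} .{{_ : NonZero o}} → (m * n * o + r) / o % n ≡ r / o % n
[m*n*o+r]/o%n≡r/o%n m r n o = begin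
  (m * n * o + r) / o % n      ≡⟨ cong (_% n) (+-distrib-/-∣ˡ r (n∣m*n (m * n))) ⟩
  (m * n * o / o + r / o) % n  ≡⟨ cong (λ x → (x + r / o) % n) (m*n/n≡m (m * n) o) ⟩
  (m * n + r / o) % n          ≡⟨ cong (_% n) (+-comm (m * n) (r / o)) ⟩
  (r / o + m * n) % n          ≡⟨ [m+kn]%n≡m%n (r / o) m n ⟩
  r / o % n                    ∎

[m*o+r]/o%n≡m : ∀ m r n o .{{_ : NonZero n}} .{{_ : NonZero o}} → m < n → r < o → (m * o + r) / o % n ≡ m
[m*o+r]/o%n≡m m r n o m<n r<o = begin
  (m * o + r) / o % n      ≡⟨ cong (_% n) (+-distrib-/-∣ˡ r (n∣m*n m)) ⟩
  (m * o / o + r / o) % n  ≡⟨ cong₂ (λ x y → (x + y) % n) (m*n/n≡m m o) (m<n⇒m/n≡0 r<o) ⟩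
  (m + 0) % n              ≡⟨ cong (_% n) (+-identityʳ m) ⟩
  m % n                    ≡⟨ m<n⇒m%n≡m m<n ⟩
  m                        ∎

bit : Bool → ℕ
bit false = 0
bit true  = 1

bit≤1 : ∀ b → bit b ≤ 1
bit≤1 false = z≤n
bit≤1 true  = ≤-refl

filter-map : ∀ {P : Pred B ℓ} (P? : Decidable P) (f : A → B) xs → filter P? (map f xs) ≡ map f (filter (P? ∘ f) xs)
filter-map P? f []       = refl
filter-map P? f (x ∷ xs) with does (P? (f x))
... | true  = cong (f x ∷_) (filter-map P? f xs)
... | false = filter-map P? f xs

filter-map-const : ∀ {P : Pred B ℓ} (P? : Decidable P) (f : A → B) {b} → (∀ x → does (P? (f x)) ≡ b) →
  ∀ xs → filter P? (map f xs) ≡ (if b then map f xs else [])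
filter-map-const P? f {true}  const [] = refl
filter-map-const P? f {false} const [] = refl
filter-map-const P? f const (x ∷ xs) with does (P? (f x)) | const x
... | true  | refl = cong (f x ∷_) (filter-map-const P? f const xs)
... | false | refl = filter-map-const P? f const xs

filter-concat : ∀ {P : Pred A ℓ} (P? : Decidable P) xss → filter P? (concat xss) ≡ concat (map (filter P?) xss)
filter-concat P? []         = refl
filter-concat P? (xs ∷ xss) = trans (filter-++ P? xs (concat xss)) (cong (filter P? xs ++_) (filter-concat P? xss))

concat-tabulate-select : ∀ m (xss : Fin m → List A) j →
  concat (tabulate λ d → if does (toℕ d ≟ toℕ j) then xss d else []) ≡ xss j
concat-tabulate-select (suc m) xss F.zero    = trans (cong (xss F.zero ++_) (nothing-selected m)) (++-identityʳ (xss F.zero))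
  where
    nothing-selected : ∀ m → concat (tabulate {n = m} λ _ → []) ≡ []
    nothing-selected zero    = refl
    nothing-selected (suc m) = nothing-selected m
concat-tabulate-select (suc m) xss (F.suc j) = concat-tabulate-select m (xss ∘ F.suc) j

applyUpTo-tabulate : ∀ (f : ℕ → A) n → applyUpTo f n ≡ tabulate {n = n} (f ∘ toℕ)
applyUpTo-tabulate f zero    = refl
applyUpTo-tabulate f (suc n) = cong (f 0 ∷_) (applyUpTo-tabulate (f ∘ suc) n)

applyUpTo-+ : ∀ (f : ℕ → A) m n → applyUpTo f (m + n) ≡ applyUpTo f m ++ applyUpTo (f ∘ (m +_)) n
applyUpTo-+ f zero    n = refl
applyUpTo-+ f (suc m) n = cong (f 0 ∷_) (applyUpTo-+ (f ∘ suc) m n)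

upTo-* : ∀ m P → upTo (m * P) ≡ concat (tabulate {n = m} λ d → map (toℕ d * P +_) (upTo P))
upTo-* zero    P = refl
upTo-* (suc m) P = begin
  upTo (P + m * P)                               ≡⟨ applyUpTo-+ id P (m * P) ⟩
  upTo P ++ applyUpTo (P +_) (m * P)             ≡⟨ cong₂ _++_ (sym (map-id (upTo P))) (sym (map-upTo (P +_) (m * P))) ⟩
  map id (upTo P) ++ map (P +_) (upTo (m * P))   ≡⟨ cong (map id (upTo P) ++_) shift ⟩
  map id (upTo P) ++ concat (tabulate (block {suc m} ∘ F.suc))  ∎
  where
    block : ∀ {m} → Fin m → List ℕ
    block d = map (toℕ d * P +_) (upTo P)
    shift : map (P +_) (upTo (m * P)) ≡ concat (tabulate (block {suc m} ∘ F.suc))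
    shift = begin
      map (P +_) (upTo (m * P))                         ≡⟨ cong (map (P +_)) (upTo-* m P) ⟩
      map (P +_) (concat (tabulate (block {m})))        ≡⟨ sym (concat-map (tabulate (block {m}))) ⟩
      concat (map (map (P +_)) (tabulate (block {m})))  ≡⟨ cong concat (map-tabulate (block {m}) (map (P +_))) ⟩
      concat (tabulate (map (P +_) ∘ block {m}))        ≡⟨ cong concat (tabulate-cong {n = m} λ d →
                                                             trans (sym (map-∘ {g = P +_} {f = toℕ d * P +_} (upTo P)))
                                                                   (map-cong (λ x → sym (+-assoc P (toℕ d * P) x)) (upTo P))) ⟩
      concat (tabulate (block {suc m} ∘ F.suc))         ∎

not-length-filter≡ᵇ0 : ∀ {P : Pred A ℓ} (P? : Decidable P) xs → not (length (filter P? xs) ≡ᵇ 0) ≡ does (any? P? xs)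
not-length-filter≡ᵇ0 P? []       = refl
not-length-filter≡ᵇ0 P? (x ∷ xs) with does (P? x)
... | true  = refl
... | false = not-length-filter≡ᵇ0 P? xs

does-any?-tabulate : ∀ {n} {P : Pred A ℓ} {Q : Pred B ℓ′} (P? : Decidable P) (Q? : Decidable Q) {f : Fin n → A} {g : Fin n → B} →
  (∀ i → does (P? (f i)) ≡ does (Q? (g i))) → does (any? P? (tabulate f)) ≡ does (any? Q? (tabulate g))
does-any?-tabulate {n = zero}  P? Q? same = refl
does-any?-tabulate {n = suc n} P? Q? same = cong₂ B._∨_ (same F.zero) (does-any?-tabulate P? Q? (same ∘ F.suc))

-- Supports of Lehmer codes
lehmerSupport : ∀ {n} → List (Fin n) → List Bool
lehmerSupport []       = []
lehmerSupport (p ∷ ps) = does (any? (F._<? p) ps) ∷ lehmerSupport ps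

laterSmaller? : ∀ {n m} (f : Fin n → Fin m) i j → Dec (i F.< j × f j F.< f i)
laterSmaller? f i j = (i F.<? j) ×-dec (f j F.<? f i)

lehmerSupport-tabulate : ∀ {n m} (f : Fin n → Fin m) →
  lehmerSupport (tabulate f) ≡ tabulate λ i → does (any? (laterSmaller? f i) (allFin n))
lehmerSupport-tabulate {zero}  f = refl
lehmerSupport-tabulate {suc n} f = cong₂ _∷_
  (does-any?-tabulate (F._<? f F.zero) (laterSmaller? f F.zero) {f ∘ F.suc} {F.suc} λ _ → refl)
  (trans (lehmerSupport-tabulate (f ∘ F.suc)) (tabulate-cong λ i →
    does-any?-tabulate (laterSmaller? (f ∘ F.suc) i) (laterSmaller? f (F.suc i)) {id} {F.suc} λ _ → refl))

supp≡lehmerSupport : ∀ {n} (w : Permutation′ n) → supp w ≡ lehmerSupport (tabulate (w ⟨$⟩ʳ_))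
supp≡lehmerSupport {n} w = begin
  map (λ i → not (lehmer w i ≡ᵇ 0)) (allFin n)   ≡⟨ map-tabulate id _ ⟩
  tabulate (λ i → not (lehmer w i ≡ᵇ 0))         ≡⟨ tabulate-cong (λ _ → not-length-filter≡ᵇ0 _ (allFin n)) ⟩
  tabulate _                                     ≡⟨ sym (lehmerSupport-tabulate (w ⟨$⟩ʳ_)) ⟩
  lehmerSupport (tabulate (w ⟨$⟩ʳ_))             ∎

length-supp : ∀ {n} (w : Permutation′ n) → length (supp w) ≡ n
length-supp {n} w = trans (length-map _ (allFin n)) (length-tabulate id)

-- Bit strings read as base-k numbers
weight : ℕ → List Bool → ℕ
weight k []       = 0
weight k (b ∷ bs) = bit b * k ^ length bs + weight k bs

weight-∷ʳ : ∀ k bs b → weight k (bs ∷ʳ b) ≡ k * weight k bs + bit b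
weight-∷ʳ k []       b = lowest-digit (bit b) k
  where
    lowest-digit : ∀ c k → c * 1 + 0 ≡ k * 0 + c
    lowest-digit = solve-∀
weight-∷ʳ k (x ∷ bs) b = begin
  bit x * k ^ length (bs ∷ʳ b) + weight k (bs ∷ʳ b)          ≡⟨ cong₂ (λ L W → bit x * k ^ L + W) (trans (length-++ bs) (+-comm (length bs) 1)) (weight-∷ʳ k bs b) ⟩
  bit x * (k * k ^ length bs) + (k * weight k bs + bit b)     ≡⟨ rearrange (bit x) k (k ^ length bs) (weight k bs) (bit b) ⟩
  k * (bit x * k ^ length bs + weight k bs) + bit b           ∎
  where
    rearrange : ∀ x k P W c → x * (k * P) + (k * W + c) ≡ k * (x * P + W) + c
    rearrange = solve-∀

weight-< : ∀ {k} → 2 ≤ k → ∀ bs → weight k bs < k ^ length bs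
weight-< 2≤k []       = s≤s z≤n
weight-< 2≤k (b ∷ bs) =
  <-≤-trans (m*o+n<[1+m]*o (bit b) (weight-< 2≤k bs)) (*-monoˡ-≤ _ (≤-trans (s≤s (bit≤1 b)) 2≤k))

weight-<⇒<lex : ∀ {k} → 2 ≤ k → ∀ xs ys → length xs ≡ length ys → weight k ys < weight k xs → ys <lex xs
weight-<⇒<lex 2≤k []       []       _   ()
weight-<⇒<lex {k} 2≤k (x ∷ xs) (y ∷ ys) len lt = compare-heads x y lt
  where
    len′ : length xs ≡ length ys
    len′ = suc-injective len
    tails : ∀ c → c * k ^ length ys + weight k ys < c * k ^ length xs + weight k xs → ys <lex xs
    tails c lt′ = weight-<⇒<lex 2≤k xs ys len′
      (+-cancelˡ-< (c * k ^ length ys) _ _ (subst (λ L → _ < c * k ^ L + weight k xs) len′ lt′))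
    compare-heads : ∀ x y → bit y * k ^ length ys + weight k ys < bit x * k ^ length xs + weight k xs → (y ∷ ys) <lex (x ∷ xs)
    compare-heads true  false _   = this B.f<t
    compare-heads false false lt′ = next refl (tails 0 lt′)
    compare-heads true  true  lt′ = next refl (tails 1 lt′)
    compare-heads false true  lt′ =
      ⊥-elim (<-irrefl refl (<-≤-trans (<-trans lt′ (weight-< 2≤k xs)) leading-weight))
      where
        leading-weight : k ^ length xs ≤ 1 * k ^ length ys + weight k ys
        leading-weight = ≤-trans (≤-reflexive (trans (cong (k ^_) len′) (sym (*-identityˡ _)))) (m≤m+n _ _)

-- Descents of concatenated lists
lastOf : ℕ → List ℕ → ℕ
lastOf x []       = x
lastOf x (y ∷ ys) = lastOf y ys

lastOf-++ : ∀ x xs y ys → lastOf x (xs ++ y ∷ ys) ≡ lastOf y ys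
lastOf-++ x []       y ys = refl
lastOf-++ x (z ∷ zs) y ys = lastOf-++ z zs y ys

descents-++ : ∀ x xs y ys →
  descents ((x ∷ xs) ++ y ∷ ys) ≡ descents (x ∷ xs) + (bit (y <ᵇ lastOf x xs) + descents (y ∷ ys))
descents-++ x []       y ys with y <ᵇ x
... | true  = refl
... | false = refl
descents-++ x (z ∷ zs) y ys with z <ᵇ x
... | true  = cong suc (descents-++ z zs y ys)
... | false = descents-++ z zs y ys

record Profile (xs : List ℕ) (first last count : ℕ) : Set where
  constructor profile
  field
    rest           : List ℕ
    xs≡first∷rest  : xs ≡ first ∷ rest
    lastOf≡last    : lastOf first rest ≡ last
    descents≡count : descents xs ≡ count

profile-[_] : ∀ x → Profile (x ∷ []) x x 0
profile-[ x ] = profile [] refl refl refl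

profile-subst : ∀ {xs ys h h′ l l′ d d′} → xs ≡ ys → h ≡ h′ → l ≡ l′ → d ≡ d′ → Profile xs h l d → Profile ys h′ l′ d′
profile-subst refl refl refl refl P = P

profile-++ : ∀ {xs ys h₁ l₁ d₁ h₂ l₂ d₂} → Profile xs h₁ l₁ d₁ → Profile ys h₂ l₂ d₂ →
  Profile (xs ++ ys) h₁ l₂ (d₁ + (bit (h₂ <ᵇ l₁) + d₂))
profile-++ (profile xs refl refl refl) (profile ys refl refl refl) =
  profile _ refl (lastOf-++ _ xs _ ys) (descents-++ _ xs _ ys)

profile-concat : ∀ m (xss : Fin (suc m) → List ℕ) (first last : Fin (suc m) → ℕ) d b →
  (∀ j → Profile (xss j) (first j) (last j) d) →
  (∀ (j : Fin m) → (first (F.suc j) <ᵇ last (inject₁ j)) ≡ b) →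
  Profile (concat (tabulate xss)) (first F.zero) (last (fromℕ m)) (suc m * d + m * bit b)
profile-concat zero xss first last d b blocks junction =
  profile-subst (sym (++-identityʳ (xss F.zero))) refl refl (one-block d (bit b)) (blocks F.zero)
  where
    one-block : ∀ d c → d ≡ 1 * d + 0 * c
    one-block = solve-∀
profile-concat (suc m) xss first last d b blocks junction =
  profile-subst refl refl refl count
    (profile-++ (blocks F.zero)
      (profile-concat m (xss ∘ F.suc) (first ∘ F.suc) (last ∘ F.suc) d b (blocks ∘ F.suc) (junction ∘ F.suc)))
  where
    count : d + (bit (first (F.suc F.zero) <ᵇ last F.zero) + (suc m * d + m * bit b)) ≡ suc (suc m) * d + suc m * bit b
    count rewrite junction F.zero = one-more-block m d (bit b)
      where
        one-more-block : ∀ m d c → d + (c + (suc m * d + m * c)) ≡ suc (suc m) * d + suc m * c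
        one-more-block = solve-∀

-- Firing below a single vertex
settle : ℕ → ℕ → List ℕ → List ℕ → List ℕ
settle k n ps chips = concat (runLayers k n ps (chips ∷ []))

runLayers-[] : ∀ k n ps → runLayers k n ps [] ≡ []
runLayers-[] k n []       = refl
runLayers-[] k n (p ∷ ps) = runLayers-[] k n ps

runLayers-++ : ∀ k n ps vs us → runLayers k n ps (vs ++ us) ≡ runLayers k n ps vs ++ runLayers k n ps us
runLayers-++ k n []       vs us = refl
runLayers-++ k n (p ∷ ps) vs us =
  trans (cong (runLayers k n ps) (concatMap-++ (fireVertex k n p) vs us)) (runLayers-++ k n ps _ _)

concat-runLayers : ∀ k n ps vs → concat (runLayers k n ps vs) ≡ concatMap (settle k n ps) vs
concat-runLayers k n ps []       = cong concat (runLayers-[] k n ps)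
concat-runLayers k n ps (v ∷ vs) = begin
  concat (runLayers k n ps (v ∷ [] ++ vs))                        ≡⟨ cong concat (runLayers-++ k n ps (v ∷ []) vs) ⟩
  concat (runLayers k n ps (v ∷ []) ++ runLayers k n ps vs)       ≡⟨ sym (concat-++ (runLayers k n ps (v ∷ [])) _) ⟩
  settle k n ps v ++ concat (runLayers k n ps vs)                 ≡⟨ cong (settle k n ps v ++_) (concat-runLayers k n ps vs) ⟩
  settle k n ps v ++ concatMap (settle k n ps) vs                 ∎

settle-∷ : ∀ k n p ps chips →
  settle k n (p ∷ ps) chips ≡ concatMap (λ j → settle k n ps (filter (λ c → digit k n p c ≟ j) chips)) (upTo k)
settle-∷ k n p ps chips = begin
  concat (runLayers k n ps (fireVertex k n p chips ++ []))      ≡⟨ cong (concat ∘ runLayers k n ps) (++-identityʳ _) ⟩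
  concat (runLayers k n ps (fireVertex k n p chips))            ≡⟨ concat-runLayers k n ps _ ⟩
  concatMap (settle k n ps) (fireVertex k n p chips)            ≡⟨ concatMap-map (settle k n ps) _ (upTo k) ⟩
  concatMap (λ j → settle k n ps (filter (λ c → digit k n p c ≟ j) chips)) (upTo k) ∎

pos : ∀ {n} → Fin n → ℕ
pos q = suc (toℕ q)

-- The base is written k = suc K so that `digit k` unfolds.
module Radix (K : ℕ) where

  k : ℕ
  k = suc K

  top : Fin k
  top = fromℕ K

  val : ∀ {n} → Vec (Fin k) n → ℕ
  val V.[]              = 0
  val {suc n} (d V.∷ v) = toℕ d * k ^ n + val v

  val-< : ∀ {n} (v : Vec (Fin k) n) → val v < k ^ n
  val-< V.[]       = s≤s z≤n
  val-< (d V.∷ v) = <-≤-trans (m*o+n<[1+m]*o (toℕ d) (val-< v)) (*-monoˡ-≤ _ (toℕ<n d))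

  val-<-head : ∀ {n} {a b : Fin k} (u u′ : Vec (Fin k) n) → toℕ a < toℕ b → val (a V.∷ u) < val (b V.∷ u′)
  val-<-head {n} {a} u u′ a<b =
    <-≤-trans (m*o+n<[1+m]*o (toℕ a) (val-< u)) (≤-trans (*-monoˡ-≤ (k ^ n) a<b) (m≤m+n _ (val u′)))

  val-<-tail : ∀ {n} (d : Fin k) (u u′ : Vec (Fin k) n) → val u < val u′ → val (d V.∷ u) < val (d V.∷ u′)
  val-<-tail {n} d _ _ = +-monoʳ-< (toℕ d * k ^ n)

  digit-val : ∀ {n} (v : Vec (Fin k) n) q → digit k n (pos q) (val v) ≡ toℕ (V.lookup v q)
  digit-val {suc n} (d V.∷ v) F.zero    = [m*o+r]/o%n≡m (toℕ d) (val v) k (k ^ n) (toℕ<n d) (val-< v)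
    where instance
      k^n≢0 : NonZero (k ^ n)
      k^n≢0 = m^n≢0 k n
  digit-val {suc n} (d V.∷ v) (F.suc q) = begin
    (toℕ d * k ^ n + val v) / k ^ e % k               ≡⟨ cong (λ x → (x + val v) / k ^ e % k) split-power ⟩
    (toℕ d * k ^ a * k * k ^ e + val v) / k ^ e % k  ≡⟨ [m*n*o+r]/o%n≡r/o%n (toℕ d * k ^ a) (val v) k (k ^ e) ⟩
    val v / k ^ e % k                                 ≡⟨ digit-val v q ⟩
    toℕ (V.lookup v q)                                ∎
    where
      a e : ℕ
      a = toℕ q
      e = n ∸ suc a
      instance
        k^e≢0 : NonZero (k ^ e)
        k^e≢0 = m^n≢0 k e
      split-power : toℕ d * k ^ n ≡ toℕ d * k ^ a * k * k ^ e
      split-power = begin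
        toℕ d * k ^ n               ≡⟨ cong (λ x → toℕ d * k ^ x) (sym (m+[n∸m]≡n (toℕ<n q))) ⟩
        toℕ d * k ^ (suc a + e)     ≡⟨ cong (toℕ d *_) (^-distribˡ-+-* k (suc a) e) ⟩
        toℕ d * (k * k ^ a * k ^ e) ≡⟨ reassociate (toℕ d) k (k ^ a) (k ^ e) ⟩
        toℕ d * k ^ a * k * k ^ e   ∎
        where
          reassociate : ∀ D k A E → D * (k * A * E) ≡ D * A * k * E
          reassociate = solve-∀

  PartialDigits : ℕ → Set
  PartialDigits = Vec (Maybe (Fin k))

  completions : ∀ {n} → PartialDigits n → List (Vec (Fin k) n)
  completions V.[]              = V.[] ∷ []
  completions (nothing V.∷ t) = concat (tabulate λ d → map (d V.∷_) (completions t))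
  completions (just d V.∷ t)  = map (d V.∷_) (completions t)

  fill : ∀ {n} → Fin k → PartialDigits n → Vec (Fin k) n
  fill c = V.map (fromMaybe c)

  fill-[]≔ : ∀ {n} (t : PartialDigits n) q c → V.lookup t q ≡ nothing → fill c (t [ q ]≔ just c) ≡ fill c t
  fill-[]≔ t q c q-free = begin
    fill c (t [ q ]≔ just c)                 ≡⟨ map-[]≔ (fromMaybe c) t q ⟩
    fill c t [ q ]≔ c                        ≡⟨ cong (fill c t [ q ]≔_) (sym lookup-fill) ⟩
    fill c t [ q ]≔ V.lookup (fill c t) q    ≡⟨ []≔-lookup (fill c t) q ⟩
    fill c t                                 ∎
    where
      lookup-fill : V.lookup (fill c t) q ≡ c
      lookup-fill = trans (lookup-map q (fromMaybe c) t) (cong (fromMaybe c) q-free)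

  completions-fixed : ∀ {n} (t : PartialDigits n) → (∀ r → V.lookup t r ≢ nothing) → ∀ c → completions t ≡ fill c t ∷ []
  completions-fixed V.[]             fixed c = refl
  completions-fixed (nothing V.∷ t) fixed c = ⊥-elim (fixed F.zero refl)
  completions-fixed (just d V.∷ t)  fixed c = cong (map (d V.∷_)) (completions-fixed t (fixed ∘ F.suc) c)

  filter-completions : ∀ {n} (t : PartialDigits n) q j → V.lookup t q ≡ nothing →
    filter (λ v → toℕ (V.lookup v q) ≟ toℕ j) (completions t) ≡ completions (t [ q ]≔ just j)
  filter-completions (nothing V.∷ t) F.zero j _ = begin
    filter P? (concat (tabulate blocks))                                   ≡⟨ filter-concat P? (tabulate blocks) ⟩
    concat (map (filter P?) (tabulate blocks))                             ≡⟨ cong concat (map-tabulate blocks (filter P?)) ⟩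
    concat (tabulate (filter P? ∘ blocks))                                 ≡⟨ cong concat (tabulate-cong λ d →
                                                                                filter-map-const P? (d V.∷_) (λ _ → refl) (completions t)) ⟩
    concat (tabulate λ d → if does (toℕ d ≟ toℕ j) then blocks d else [])  ≡⟨ concat-tabulate-select k blocks j ⟩
    blocks j                                                               ∎
    where
      P? : Decidable (λ (v : Vec (Fin k) _) → toℕ (V.lookup v F.zero) ≡ toℕ j)
      P? v = toℕ (V.lookup v F.zero) ≟ toℕ j
      blocks : Fin k → List (Vec (Fin k) _)
      blocks d = map (d V.∷_) (completions t)
  filter-completions (nothing V.∷ t) (F.suc q) j q-free = begin
    filter P? (concat (tabulate blocks))                         ≡⟨ filter-concat P? (tabulate blocks) ⟩
    concat (map (filter P?) (tabulate blocks))                   ≡⟨ cong concat (map-tabulate blocks (filter P?)) ⟩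
    concat (tabulate (filter P? ∘ blocks))                       ≡⟨ cong concat (tabulate-cong λ d → prefixed d) ⟩
    concat (tabulate λ d → map (d V.∷_) (completions (t [ q ]≔ just j))) ∎
    where
      P? : Decidable (λ (v : Vec (Fin k) _) → toℕ (V.lookup v (F.suc q)) ≡ toℕ j)
      P? v = toℕ (V.lookup v (F.suc q)) ≟ toℕ j
      blocks : Fin k → List (Vec (Fin k) _)
      blocks d = map (d V.∷_) (completions t)
      prefixed : ∀ d → filter P? (map (d V.∷_) (completions t)) ≡ map (d V.∷_) (completions (t [ q ]≔ just j))
      prefixed d = trans (filter-map P? (d V.∷_) (completions t)) (cong (map (d V.∷_)) (filter-completions t q j q-free))
  filter-completions (just d V.∷ t) (F.suc q) j q-free =
    trans (filter-map _ (d V.∷_) (completions t)) (cong (map (d V.∷_)) (filter-completions t q j q-free))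

  filter-digit-completions : ∀ {n} (t : PartialDigits n) q j → V.lookup t q ≡ nothing →
    filter (λ c → digit k n (pos q) c ≟ toℕ j) (map val (completions t)) ≡ map val (completions (t [ q ]≔ just j))
  filter-digit-completions {n} t q j q-free = begin
    filter D? (map val (completions t))          ≡⟨ filter-map D? val (completions t) ⟩
    map val (filter (D? ∘ val) (completions t))  ≡⟨ cong (map val) (filter-≐ (D? ∘ val) L? digit≐lookup (completions t)) ⟩
    map val (filter L? (completions t))          ≡⟨ cong (map val) (filter-completions t q j q-free) ⟩
    map val (completions (t [ q ]≔ just j))      ∎
    where
      D? : Decidable (λ c → digit k n (pos q) c ≡ toℕ j)
      D? c = digit k n (pos q) c ≟ toℕ j
      L? : Decidable (λ v → toℕ (V.lookup v q) ≡ toℕ j)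
      L? v = toℕ (V.lookup v q) ≟ toℕ j
      digit≐lookup : (λ v → digit k n (pos q) (val v) ≡ toℕ j) ≐ (λ v → toℕ (V.lookup v q) ≡ toℕ j)
      digit≐lookup = (λ {v} → trans (sym (digit-val v q))) , (λ {v} → trans (digit-val v q))

  junction-descent : ∀ {n} (t : PartialDigits n) q (a b : Fin k) → 0 < K → (∃ λ r → r F.< q × V.lookup t r ≡ nothing) →
    val (fill F.zero (t [ q ]≔ just b)) < val (fill top (t [ q ]≔ just a))
  junction-descent (x V.∷ t)       F.zero    a b _   (r , () , _)
  junction-descent (nothing V.∷ t) (F.suc q) a b 0<K _ =
    val-<-head (fill F.zero (t [ q ]≔ just b)) (fill top (t [ q ]≔ just a))
               (subst (0 <_) (sym (toℕ-fromℕ K)) 0<K)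
  junction-descent (just d V.∷ t)  (F.suc q) a b _   (F.zero , _ , ())
  junction-descent (just d V.∷ t)  (F.suc q) a b 0<K (F.suc r , s≤s r<q , r-free) =
    val-<-tail d (fill F.zero (t [ q ]≔ just b)) (fill top (t [ q ]≔ just a))
               (junction-descent t q a b 0<K (r , r<q , r-free))

  junction-ascent : ∀ {n} (t : PartialDigits n) q (a b : Fin k) → toℕ a < toℕ b → (∀ r → r F.< q → V.lookup t r ≢ nothing) →
    val (fill top (t [ q ]≔ just a)) < val (fill F.zero (t [ q ]≔ just b))
  junction-ascent (x V.∷ t)       F.zero    a b a<b _     = val-<-head (fill top t) (fill F.zero t) a<b
  junction-ascent (nothing V.∷ t) (F.suc q) a b a<b fixed = ⊥-elim (fixed F.zero (s≤s z≤n) refl)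
  junction-ascent (just d V.∷ t)  (F.suc q) a b a<b fixed =
    val-<-tail d (fill top (t [ q ]≔ just a)) (fill F.zero (t [ q ]≔ just b))
               (junction-ascent t q a b a<b λ r r<q → fixed (F.suc r) (s≤s r<q))

  FreeExactlyAt : ∀ {n} → PartialDigits n → List (Fin n) → Set
  FreeExactlyAt t ps = ∀ r → V.lookup t r ≡ nothing ⇔ r ∈ ps

  freeExactlyAt-[]≔ : ∀ {n} {p ps} (t : PartialDigits n) → All (p ≢_) ps → FreeExactlyAt t (p ∷ ps) → ∀ j →
    FreeExactlyAt (t [ p ]≔ just j) ps
  freeExactlyAt-[]≔ {p = p} t p∉ps free j r with r F.≟ p
  ... | yes refl = mk⇔ (λ e → case trans (sym (lookup∘update p t (just j))) e of λ ())
                       (λ r∈ps → ⊥-elim (All.lookup p∉ps r∈ps refl))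
  ... | no r≢p = mk⇔ (λ e → not-head (to (free r) (trans (sym (lookup∘update′ r≢p t (just j))) e)))
                     (λ r∈ps → trans (lookup∘update′ r≢p t (just j)) (from (free r) (there r∈ps)))
    where
      not-head : r ∈ p ∷ _ → r ∈ _
      not-head (here r≡p)  = ⊥-elim (r≢p r≡p)
      not-head (there r∈ps) = r∈ps

  junction : ∀ {n} p ps (t : PartialDigits n) → FreeExactlyAt t (p ∷ ps) → (j : Fin K) →
    (val (fill F.zero (t [ p ]≔ just (F.suc j))) <ᵇ val (fill top (t [ p ]≔ just (inject₁ j)))) ≡ does (any? (F._<? p) ps)
  junction p ps t free j with any? (F._<? p) ps
  ... | yes later-smaller with find later-smaller
  ...   | r , r∈ps , r<p =
    dec-true (_ <? _) (junction-descent t p (inject₁ j) (F.suc j) (≤-<-trans z≤n (toℕ<n j)) (r , r<p , from (free r) (there r∈ps)))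
  junction p ps t free j | no none-smaller =
    dec-false (_ <? _) (<⇒≯ (junction-ascent t p (inject₁ j) (F.suc j) (≤̄⇒inject₁< ≤-refl) fixed-before-p))
    where
      fixed-before-p : ∀ r → r F.< p → V.lookup t r ≢ nothing
      fixed-before-p r r<p r-free with to (free r) r-free
      ... | here refl   = <-irrefl refl r<p
      ... | there r∈ps = none-smaller (lose r∈ps r<p)

  settle-split : ∀ {n} p ps (t : PartialDigits n) → V.lookup t p ≡ nothing →
    settle k n (pos p ∷ ps) (map val (completions t))
      ≡ concat (tabulate λ j → settle k n ps (map val (completions (t [ p ]≔ just j))))
  settle-split {n} p ps t p-free = begin
    settle k n (pos p ∷ ps) chips                                                     ≡⟨ settle-∷ k n (pos p) ps chips ⟩
    concatMap branch (upTo k)                                                         ≡⟨ cong concat (trans (map-upTo branch k) (applyUpTo-tabulate branch k)) ⟩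
    concat (tabulate {n = k} (branch ∘ toℕ))                                          ≡⟨ cong concat (tabulate-cong λ j →
                                                                                           cong (settle k n ps) (filter-digit-completions t p j p-free)) ⟩
    concat (tabulate blocks)                                                          ∎
    where
      chips : List ℕ
      chips = map val (completions t)
      branch : ℕ → List ℕ
      branch j = settle k n ps (filter (λ c → digit k n (pos p) c ≟ j) chips)
      blocks : Fin k → List ℕ
      blocks j = settle k n ps (map val (completions (t [ p ]≔ just j)))

  descent-count : ∀ b bs → k * (K * weight k (reverse bs)) + K * bit b ≡ K * weight k (reverse (b ∷ bs))
  descent-count b bs = begin
    k * (K * weight k (reverse bs)) + K * bit b  ≡⟨ factor-K K (weight k (reverse bs)) (bit b) ⟩
    K * (k * weight k (reverse bs) + bit b)      ≡⟨ cong (K *_) (sym (weight-∷ʳ k (reverse bs) b)) ⟩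
    K * weight k (reverse bs ∷ʳ b)               ≡⟨ cong (λ xs → K * weight k xs) (sym (unfold-reverse b bs)) ⟩
    K * weight k (reverse (b ∷ bs))              ∎
    where
      factor-K : ∀ K W c → suc K * (K * W) + K * c ≡ K * (suc K * W + c)
      factor-K = solve-∀

  profile-settle : ∀ {n} (ps : List (Fin n)) (t : PartialDigits n) → Unique ps → FreeExactlyAt t ps →
    Profile (settle k n (map pos ps) (map val (completions t)))
            (val (fill F.zero t)) (val (fill top t)) (K * weight k (reverse (lehmerSupport ps)))
  profile-settle [] t _ free =
    profile-subst (cong (λ vs → map val vs ++ []) (sym (as-fill F.zero))) refl
                  (cong val (∷-injectiveˡ (trans (sym (as-fill F.zero)) (as-fill top)))) (sym (*-zeroʳ K))
                  profile-[ val (fill F.zero t) ]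
    where
      as-fill : ∀ c → completions t ≡ fill c t ∷ []
      as-fill = completions-fixed t λ r r-free → case to (free r) r-free of λ ()
  profile-settle (p ∷ ps) t (p∉ps ∷ ps-unique) free =
    profile-subst (sym (settle-split p (map pos ps) t p-free))
                  (cong val (fill-[]≔ t p F.zero p-free)) (cong val (fill-[]≔ t p top p-free))
                  (descent-count (does (any? (F._<? p) ps)) (lehmerSupport ps))
      (profile-concat K (λ j → settle k _ (map pos ps) (map val (completions (t [ p ]≔ just j))))
                        (λ j → val (fill F.zero (t [ p ]≔ just j))) (λ j → val (fill top (t [ p ]≔ just j)))
                        _ _ (λ j → profile-settle ps (t [ p ]≔ just j) ps-unique (freeExactlyAt-[]≔ t p∉ps free j))
                        (junction p ps t free))
    where
      p-free : V.lookup t p ≡ nothing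
      p-free = from (free p) (here refl)

  upTo-completions : ∀ n → upTo (k ^ n) ≡ map val (completions (V.replicate n nothing))
  upTo-completions zero    = refl
  upTo-completions (suc n) = begin
    upTo (k * P)                                                ≡⟨ upTo-* k P ⟩
    concat (tabulate range)                                     ≡⟨ cong concat (tabulate-cong shifted) ⟩
    concat (tabulate (map val ∘ blocks))                        ≡⟨ cong concat (sym (map-tabulate blocks (map val))) ⟩
    concat (map (map val) (tabulate blocks))                    ≡⟨ concat-map (tabulate blocks) ⟩
    map val (concat (tabulate blocks))                          ∎
    where
      P : ℕ
      P = k ^ n
      C : List (Vec (Fin k) n)
      C = completions (V.replicate n nothing)
      range : Fin k → List ℕ
      range d = map (toℕ d * P +_) (upTo P)
      blocks : Fin k → List (Vec (Fin k) (suc n))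
      blocks d = map (d V.∷_) C
      shifted : ∀ d → range d ≡ map val (blocks d)
      shifted d = begin
        map (toℕ d * P +_) (upTo P)       ≡⟨ cong (map (toℕ d * P +_)) (upTo-completions n) ⟩
        map (toℕ d * P +_) (map val C)    ≡⟨ sym (map-∘ {g = toℕ d * P +_} {f = val} C) ⟩
        map (val ∘ (d V.∷_)) C            ≡⟨ map-∘ {g = val} {f = d V.∷_} C ⟩
        map val (blocks d)                ∎

  descents-config : ∀ {n} (w : Permutation′ n) → descents (config k n w) ≡ K * weight k (reverse (supp w))
  descents-config {n} w = begin
    descents (config k n w)                                                     ≡⟨ cong descents config≡settle ⟩
    descents (settle k n (map pos ps) (map val (completions (V.replicate n nothing))))
                                                                                ≡⟨ Profile.descents≡count (profile-settle ps (V.replicate n nothing) ps-unique all-free) ⟩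
    K * weight k (reverse (lehmerSupport ps))                                   ≡⟨ cong (λ bs → K * weight k (reverse bs)) (sym (supp≡lehmerSupport w)) ⟩
    K * weight k (reverse (supp w))                                             ∎
    where
      ps : List (Fin n)
      ps = tabulate (w ⟨$⟩ʳ_)
      config≡settle : config k n w ≡ settle k n (map pos ps) (map val (completions (V.replicate n nothing)))
      config≡settle = cong₂ (settle k n) (trans (map-tabulate id (wpos w)) (sym (map-tabulate (w ⟨$⟩ʳ_) pos))) (upTo-completions n)
      ps-unique : Unique ps
      ps-unique = tabulate⁺ (Injection.injective (Inverse⇒Injection w))
      all-free : FreeExactlyAt (V.replicate n nothing) ps
      all-free r = mk⇔ (λ _ → subst (_∈ ps) (inverseʳ w) (∈-tabulate⁺ (w ⟨$⟩ˡ r))) (λ _ → lookup-replicate r nothing)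

theorem5p9 : (k n : ℕ) → 2 ≤ k → (w w′ : Permutation′ n) →
    descents (config k n w) > descents (config k n w′) →
    reverse (supp w′) <lex reverse (supp w)
theorem5p9 (suc (suc K)) n (s≤s (s≤s z≤n)) w w′ more-descents =
  weight-<⇒<lex (s≤s (s≤s z≤n)) (reverse (supp w)) (reverse (supp w′)) same-length
    (*-cancelˡ-< (suc K) _ _ (subst₂ _<_ (descents-config w′) (descents-config w) more-descents))
  where
    open Radix (suc K)
    length-reverse-supp : ∀ v → length (reverse (supp v)) ≡ n
    length-reverse-supp v = trans (length-reverse (supp v)) (length-supp v)
    same-length : length (reverse (supp w)) ≡ length (reverse (supp w′))
    same-length = trans (length-reverse-supp w) (sym (length-reverse-supp w′))
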